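{- Let $s,t \geq 1$ be integers and let $\beta_{s,t}$ be the type-$\beta$ comb with $s$ teeth of length $t$. Then the number of linear extensions of $\beta_{s,t}$ that avoid both patterns $231$ and $321$ equals $t^{s-1}$.
   Context: A linear extension of a finite poset $P$ on a set of integers is a listing $v=[v_1,\dots,v_n]$ of all elements of $P$, each exactly once, such that whenever $a \leq_P b$, $a$ appears before $b$. For $w \in S_3$, a sequence $v$ of distinct integers contains $w$ if there are indices $i<j<k$ with $(v_i,v_j,v_k)$ in the same relative order as $(w_1,w_2,w_3)$; otherwise $v$ avoids $w$. The type-$\beta$ comb $\beta_{s,t}$ is the poset on $\{1,\dots,st\}$ whose order is generated by the relations $ct+1 \leq (c+1)t+1$ for $0 \leq c \leq s-2$ (the spine) and $ct+j \leq ct+j+1$ for $0 \leq c \leq s-1$, $1 \leq j \leq t-1$ (the teeth $\{ct+1,\dots,ct+t\}$). -}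

module Defs where

open import Data.Nat using (ℕ; suc; _+_; _*_; _≤_; _<_)
open import Data.Fin using (Fin; toℕ)
open import Data.List using (List; length; lookup)
open import Data.List.Membership.Propositional using (_∈_)
open import Data.List.Relation.Unary.Unique.Propositional using (Unique)
open import Data.Product using (_×_; ∃-syntax)
open import Function.Bundles using (_⇔_)
open import Relation.Nullary using (¬_)
open import Relation.Binary.PropositionalEquality using (_≡_)
open import Relation.Binary.Construct.Closure.ReflexiveTransitive using (Star)

data CombGen (s t : ℕ) : ℕ → ℕ → Set where
  spine : (c : ℕ) → c + 2 ≤ s → CombGen s t (c * t + 1) (suc c * t + 1)
  tooth : (c j : ℕ) → c < s → 1 ≤ j → j + 1 ≤ t → CombGen s t (c * t + j) (c * t + j + 1)

_≤β[_,_]_ : ℕ → ℕ → ℕ → ℕ → Set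
a ≤β[ s , t ] b = Star (CombGen s t) a b

IsLinearExtension : ℕ → ℕ → List ℕ → Set
IsLinearExtension s t v =
  Unique v ×
  (∀ x → (x ∈ v) ⇔ (1 ≤ x × x ≤ s * t)) ×
  (∀ a b → a ≤β[ s , t ] b → (i j : Fin (length v)) →
     lookup v i ≡ a → lookup v j ≡ b → toℕ i ≤ toℕ j)

SameOrder : ℕ → ℕ → ℕ → ℕ → ℕ → ℕ → Set
SameOrder x₁ x₂ x₃ y₁ y₂ y₃ =
  ((x₁ < x₂) ⇔ (y₁ < y₂)) × ((x₁ < x₃) ⇔ (y₁ < y₃)) × ((x₂ < x₃) ⇔ (y₂ < y₃)) ×
  ((x₂ < x₁) ⇔ (y₂ < y₁)) × ((x₃ < x₁) ⇔ (y₃ < y₁)) × ((x₃ < x₂) ⇔ (y₃ < y₂))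

Contains : ℕ → ℕ → ℕ → List ℕ → Set
Contains w₁ w₂ w₃ v =
  ∃[ i ] ∃[ j ] ∃[ k ] (toℕ {length v} i < toℕ j × toℕ j < toℕ k ×
    SameOrder (lookup v i) (lookup v j) (lookup v k) w₁ w₂ w₃)

Avoids : ℕ → ℕ → ℕ → List ℕ → Set
Avoids w₁ w₂ w₃ v = ¬ Contains w₁ w₂ w₃ v

-- Build the extension from the left.  Its entries being distinct, avoiding 231 and 321 means that
-- no entry lies below two earlier ones.  Suppose 1, …, a − 1 have been listed, with a = ct + j on
-- tooth c.  Every unlisted element other than a still has an unlisted predecessor, except the base
-- h = (c+1)t + 1 of the next tooth when 2 ≤ j; so the next entry is a or h.  After h, the entries
-- a, …, ct + t lie below h, so they must follow at once and in increasing order.  Hence the number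
-- R(a) of completions satisfies R(ct + 1) = R(ct + 2), R(ct + j) = R(ct + j + 1) + R(h + 1) for
-- 2 ≤ j ≤ t, and R = 1 on the last tooth, whence R(ct + 1) = t · R((c+1)t + 1) and R(1) = t^(s−1).

module Submission where

open import Defs
open import Data.Nat using (ℕ; zero; suc; _+_; _*_; _∸_; _^_; _≤_; _<_; z≤n; s≤s; s≤s⁻¹; z<s; s<s; _≤?_; _<?_)
open import Data.Nat.Properties
open import Data.Fin using (Fin; toℕ; zero; suc)
open import Data.List using (List; []; _∷_; length; lookup; map; _++_)
open import Data.List.Properties using (∷-injectiveʳ; ∷-injectiveˡ; length-map; length-++; ++-cancelˡ)
open import Data.List.Membership.Propositional using (_∈_)
open import Data.List.Membership.Propositional.Properties using (∈-lookup; ∈-map⁺; ∈-map⁻; ∈-++⁺ˡ; ∈-++⁺ʳ; ∈-++⁻)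
open import Data.List.Relation.Unary.Any using (here; there)
open import Data.List.Relation.Unary.All as All using (All; []; _∷_)
open import Data.List.Relation.Unary.All.Properties as All using ()
open import Data.List.Relation.Unary.AllPairs as AllPairs using (AllPairs; []; _∷_)
open import Data.List.Relation.Unary.AllPairs.Properties as AllPairs using ()
open import Data.List.Relation.Binary.Permutation.Propositional using (_↭_; ↭-sym)
open import Data.List.Relation.Binary.Permutation.Propositional.Properties using (∈-resp-↭; shift)
open import Data.List.Relation.Unary.Unique.Propositional using (Unique)
open import Data.List.Relation.Unary.Unique.Propositional.Properties as Unique using ()
open import Data.Product using (_×_; _,_; proj₁; proj₂; ∃-syntax)
open import Data.Sum using (_⊎_; inj₁; inj₂; [_,_]′)
open import Data.Empty using (⊥; ⊥-elim)
open import Function using (_∘_; id)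
open import Function.Bundles using (_⇔_; mk⇔; Equivalence)
open import Function.Definitions using (Injective)
open import Function.Properties.Equivalence using () renaming (sym to ⇔-sym; trans to ⇔-trans)
open import Relation.Nullary using (¬_; yes; no)
open import Relation.Binary using (tri<; tri≈; tri>)
open import Relation.Binary.PropositionalEquality using (_≡_; _≢_; refl; sym; trans; cong; cong₂; subst; subst₂; module ≡-Reasoning)
open import Relation.Binary.Construct.Closure.ReflexiveTransitive using (ε; _◅_; _◅◅_)

module _ {A : Set} where

  all-lookup⁺ : ∀ {P : A → Set} {w : List A} → (∀ k → P (lookup w k)) → All P w
  all-lookup⁺ {w = []}    _ = []
  all-lookup⁺ {w = _ ∷ _} p = p zero ∷ all-lookup⁺ (p ∘ suc)

  module _ {R : A → A → Set} where

    AllPairs-lookup⁻ : ∀ {v} → AllPairs R v →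
      ∀ i j → toℕ {length v} i < toℕ j → R (lookup v i) (lookup v j)
    AllPairs-lookup⁻ (px ∷ _)  zero    (suc j) _   = All.lookup px (∈-lookup j)
    AllPairs-lookup⁻ (_ ∷ pxs) (suc i) (suc j) i<j = AllPairs-lookup⁻ pxs i j (s≤s⁻¹ i<j)

    AllPairs-lookup⁺ : ∀ {v} →
      (∀ i j → toℕ {length v} i < toℕ j → R (lookup v i) (lookup v j)) → AllPairs R v
    AllPairs-lookup⁺ {[]}    _ = []
    AllPairs-lookup⁺ {_ ∷ _} p =
      all-lookup⁺ (λ k → p zero (suc k) z<s) ∷
      AllPairs-lookup⁺ (λ i j i<j → p (suc i) (suc j) (s<s i<j))

  data AllTriples (T : A → A → A → Set) : List A → Set where
    []  : AllTriples T []
    _∷_ : ∀ {x xs} → AllPairs (T x) xs → AllTriples T xs → AllTriples T (x ∷ xs)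

  module _ {T : A → A → A → Set} where

    AllTriples-lookup⁻ : ∀ {v} → AllTriples T v → ∀ i j k →
      toℕ {length v} i < toℕ j → toℕ j < toℕ k → T (lookup v i) (lookup v j) (lookup v k)
    AllTriples-lookup⁻ (px ∷ _)  zero    (suc j) (suc k) _   j<k = AllPairs-lookup⁻ px j k (s≤s⁻¹ j<k)
    AllTriples-lookup⁻ (_ ∷ pxs) (suc i) (suc j) (suc k) i<j j<k =
      AllTriples-lookup⁻ pxs i j k (s≤s⁻¹ i<j) (s≤s⁻¹ j<k)

    AllTriples-lookup⁺ : ∀ {v} → (∀ i j k → toℕ {length v} i < toℕ j → toℕ j < toℕ k →
      T (lookup v i) (lookup v j) (lookup v k)) → AllTriples T v
    AllTriples-lookup⁺ {[]}    _ = []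
    AllTriples-lookup⁺ {_ ∷ _} p =
      AllPairs-lookup⁺ (λ j k j<k → p zero (suc j) (suc k) z<s (s<s j<k)) ∷
      AllTriples-lookup⁺ (λ i j k i<j j<k → p (suc i) (suc j) (suc k) (s<s i<j) (s<s j<k))

ListedInOrder : (ℕ → ℕ → Set) → List ℕ → Set
ListedInOrder _≼_ v = ∀ a b → a ≼ b → (i j : Fin (length v)) →
  lookup v i ≡ a → lookup v j ≡ b → toℕ i ≤ toℕ j

module _ {_≼_ : ℕ → ℕ → Set} where

  ListedInOrder⇔AllPairs : ∀ v → ListedInOrder _≼_ v ⇔ AllPairs (λ x y → ¬ y ≼ x) v
  ListedInOrder⇔AllPairs v = mk⇔
    (λ ord → AllPairs-lookup⁺ λ i j i<j j≼i → <⇒≱ i<j (ord _ _ j≼i j i refl refl))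
    (λ { ap _ _ x≼y i j refl refl → ≮⇒≥ λ j<i → AllPairs-lookup⁻ ap j i j<i x≼y })

BelowBoth : ℕ → ℕ → ℕ → Set
BelowBoth x y z = z < x × z < y

private
  true⇔ : ∀ {A B : Set} → A → B → A ⇔ B
  true⇔ a b = mk⇔ (λ _ → b) (λ _ → a)

  false⇔ : ∀ {A B : Set} → ¬ A → ¬ B → A ⇔ B
  false⇔ ¬a ¬b = mk⇔ (⊥-elim ∘ ¬a) (⊥-elim ∘ ¬b)

SameOrder-231 : ∀ {x y z} → x < y → BelowBoth x y z → SameOrder x y z 2 3 1
SameOrder-231 x<y (z<x , z<y) =
  true⇔ x<y (s≤s (s≤s (s≤s z≤n))) , false⇔ (<⇒≯ z<x) (λ { (s≤s ()) }) , false⇔ (<⇒≯ z<y) (λ { (s≤s ()) }) ,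
  false⇔ (<⇒≯ x<y) (λ { (s≤s (s≤s ())) }) , true⇔ z<x (s≤s (s≤s z≤n)) , true⇔ z<y (s≤s (s≤s z≤n))

SameOrder-321 : ∀ {x y z} → y < x → BelowBoth x y z → SameOrder x y z 3 2 1
SameOrder-321 y<x (z<x , z<y) =
  false⇔ (<⇒≯ y<x) (λ { (s≤s (s≤s ())) }) , false⇔ (<⇒≯ z<x) (λ { (s≤s ()) }) , false⇔ (<⇒≯ z<y) (λ { (s≤s ()) }) ,
  true⇔ y<x (s≤s (s≤s (s≤s z≤n))) , true⇔ z<x (s≤s (s≤s z≤n)) , true⇔ z<y (s≤s (s≤s z≤n))

SameOrder⇒BelowBoth : ∀ {x y z w₁ w₂ w₃} → SameOrder x y z w₁ w₂ w₃ →
  BelowBoth w₁ w₂ w₃ → BelowBoth x y z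
SameOrder⇒BelowBoth (_ , _ , _ , _ , ≡₃₁ , ≡₃₂) (w₃<w₁ , w₃<w₂) =
  Equivalence.from ≡₃₁ w₃<w₁ , Equivalence.from ≡₃₂ w₃<w₂

above⇒¬BelowBoth : ∀ {x w} → All (x <_) w → AllPairs (λ y z → ¬ BelowBoth x y z) w
above⇒¬BelowBoth []          = []
above⇒¬BelowBoth (_ ∷ x<w) = All.map (λ x<z (z<x , _) → <-asym x<z z<x) x<w ∷ above⇒¬BelowBoth x<w

-- Up to relative order, 231 and 321 are the two patterns whose last entry is below both others.
Avoids231∧321⇔AllTriples : ∀ v → Unique v →
  (Avoids 2 3 1 v × Avoids 3 2 1 v) ⇔ AllTriples (λ x y z → ¬ BelowBoth x y z) v
Avoids231∧321⇔AllTriples v u = mk⇔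
  (λ (¬231 , ¬321) → AllTriples-lookup⁺ λ i j k i<j j<k below → pattern-at i j k i<j j<k below ¬231 ¬321)
  (λ noBelow → AllTriples⇒Avoids noBelow , AllTriples⇒Avoids noBelow)
  where
  pattern-at : ∀ i j k → toℕ {length v} i < toℕ j → toℕ j < toℕ k →
    BelowBoth (lookup v i) (lookup v j) (lookup v k) → Avoids 2 3 1 v → Avoids 3 2 1 v → ⊥
  pattern-at i j k i<j j<k below ¬231 ¬321 with <-cmp (lookup v i) (lookup v j)
  ... | tri< x<y _ _ = ¬231 (i , j , k , i<j , j<k , SameOrder-231 x<y below)
  ... | tri≈ _ x≡y _ = AllPairs-lookup⁻ u i j i<j x≡y
  ... | tri> _ _ y<x = ¬321 (i , j , k , i<j , j<k , SameOrder-321 y<x below)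
  AllTriples⇒Avoids : ∀ {m n} → AllTriples (λ x y z → ¬ BelowBoth x y z) v → Avoids (2 + m) (2 + n) 1 v
  AllTriples⇒Avoids noBelow (i , j , k , i<j , j<k , ord) =
    AllTriples-lookup⁻ noBelow i j k i<j j<k (SameOrder⇒BelowBoth ord (s≤s (s≤s z≤n) , s≤s (s≤s z≤n)))

module _ {A : Set} where

  Enumeration : (A → Set) → ℕ → Set
  Enumeration P n = ∃[ L ] (Unique L × (∀ v → (v ∈ L) ⇔ P v) × length L ≡ n)

  Image : (A → A) → (A → Set) → A → Set
  Image f P v = ∃[ w ] (v ≡ f w × P w)

  module _ {P Q : A → Set} where

    Enumeration-resp-⇔ : ∀ {n} → (∀ v → P v ⇔ Q v) → Enumeration P n → Enumeration Q n
    Enumeration-resp-⇔ P⇔Q (L , u , L⇔P , len) =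
      L , u , (λ v → ⇔-trans (L⇔P v) (P⇔Q v)) , len

    Enumeration-⊎ : ∀ {n m} → (∀ v → P v → ¬ Q v) →
      Enumeration P n → Enumeration Q m → Enumeration (λ v → P v ⊎ Q v) (n + m)
    Enumeration-⊎ P⇒¬Q (L , uL , L⇔P , lenL) (M , uM , M⇔Q , lenM) =
      L ++ M ,
      Unique.++⁺ uL uM (λ (v∈L , v∈M) → P⇒¬Q _ (Equivalence.to (L⇔P _) v∈L) (Equivalence.to (M⇔Q _) v∈M)) ,
      (λ v → mk⇔
        ([ inj₁ ∘ Equivalence.to (L⇔P v) , inj₂ ∘ Equivalence.to (M⇔Q v) ]′ ∘ ∈-++⁻ L)
        [ ∈-++⁺ˡ ∘ Equivalence.from (L⇔P v) , ∈-++⁺ʳ L ∘ Equivalence.from (M⇔Q v) ]′) ,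
      trans (length-++ L) (cong₂ _+_ lenL lenM)

  Enumeration-map : ∀ {P : A → Set} {n} {f : A → A} → Injective _≡_ _≡_ f →
    Enumeration P n → Enumeration (Image f P) n
  Enumeration-map {f = f} f-inj (L , u , L⇔P , len) =
    map f L , Unique.map⁺ f-inj u ,
    (λ v → mk⇔
      (λ v∈fL → let (w , w∈L , v≡fw) = ∈-map⁻ f v∈fL in w , v≡fw , Equivalence.to (L⇔P w) w∈L)
      (λ { (w , refl , Pw) → ∈-map⁺ f (Equivalence.from (L⇔P w) Pw) })) ,
    trans (length-map f L) len

run : ℕ → ℕ → List ℕ
run p zero    = []
run p (suc n) = p ∷ run (suc p) n

∈-run⁻ : ∀ {y} p n → y ∈ run p n → p ≤ y × y < p + n
∈-run⁻ p (suc n) (here refl) = ≤-refl , m<m+n p z<s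
∈-run⁻ {y} p (suc n) (there y∈run) =
  let p<y , y<p+n = ∈-run⁻ (suc p) n y∈run in <⇒≤ p<y , subst (y <_) (sym (+-suc p n)) y<p+n

All-run : ∀ {P : ℕ → Set} p n → (∀ {y} → p ≤ y → y < p + n → P y) → All P (run p n)
All-run p n P-between = All.tabulate λ y∈run → let p≤y , y<p+n = ∈-run⁻ p n y∈run in P-between p≤y y<p+n

run-increasing : ∀ p n → AllPairs _<_ (run p n)
run-increasing p zero    = []
run-increasing p (suc n) = All-run (suc p) n (λ p<y _ → p<y) ∷ run-increasing (suc p) n

interval-tail : ∀ {p x} {B : Set} → ((p ≤ x × B) × x ≢ p) ⇔ (p < x × B)
interval-tail = mk⇔
  (λ ((p≤x , b) , x≢p) → ≤∧≢⇒< p≤x (x≢p ∘ sym) , b)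
  (λ (p<x , b) → (<⇒≤ p<x , b) , >⇒≢ p<x)

∈-tail⇔ : ∀ {A : Set} {P : A → Set} {y r} → Unique (y ∷ r) →
  (∀ x → x ∈ y ∷ r ⇔ P x) → ∀ x → x ∈ r ⇔ (P x × x ≢ y)
∈-tail⇔ {y = y} {r} (y∉r ∷ _) y∷r⇔P x = mk⇔
  (λ x∈r → Equivalence.to (y∷r⇔P x) (there x∈r) , λ x≡y → All.lookup y∉r x∈r (sym x≡y))
  (λ (Px , x≢y) → tail (Equivalence.from (y∷r⇔P x) Px) x≢y)
  where
  tail : ∀ {x} → x ∈ _ ∷ r → x ≢ y → x ∈ r
  tail (here x≡y) x≢y = ⊥-elim (x≢y x≡y)
  tail (there x∈r) _  = x∈r

comb-< : ∀ {t c c' j j'} → c < c' → j ≤ t → 1 ≤ j' → c * t + j < c' * t + j'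
comb-< {t} {c} {c'} {j} {j'} c<c' j≤t 1≤j' = begin-strict
  c * t + j    ≤⟨ +-monoʳ-≤ (c * t) j≤t ⟩
  c * t + t    ≡⟨ +-comm (c * t) t ⟩
  suc c * t    ≤⟨ *-monoˡ-≤ t c<c' ⟩
  c' * t       <⟨ m<m+n (c' * t) 1≤j' ⟩
  c' * t + j'  ∎
  where open ≤-Reasoning

next-tooth-base : ∀ t c → suc c * t + 1 ≡ suc (c * t + t)
next-tooth-base t c = trans (+-comm (t + c * t) 1) (cong suc (+-comm t (c * t)))

comb-coordinates : ∀ {t} → 1 ≤ t → ∀ x → 1 ≤ x → ∃[ c ] ∃[ j ] (1 ≤ j × j ≤ t × x ≡ c * t + j)
comb-coordinates 1≤t (suc zero) _ = 0 , 1 , ≤-refl , 1≤t , refl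
comb-coordinates {t} 1≤t (suc (suc x)) _
  with c , j , 1≤j , j≤t , x+1≡ ← comb-coordinates 1≤t (suc x) (s≤s z≤n)
  with m≤n⇒m<n∨m≡n j≤t
... | inj₁ j<t  = c , suc j , s≤s z≤n , j<t , trans (cong suc x+1≡) (sym (+-suc (c * t) j))
... | inj₂ refl = suc c , 1 , s≤s z≤n , 1≤t , trans (cong suc x+1≡) (sym (next-tooth-base t c))

module Comb (s t : ℕ) where

  N : ℕ
  N = s * t

  _≤β_ : ℕ → ℕ → Set
  x ≤β y = x ≤β[ s , t ] y

  base top : ℕ → ℕ
  base c = c * t + 1
  top  c = c * t + t

  CombGen⇒≤ : ∀ {x y} → CombGen s t x y → x ≤ y
  CombGen⇒≤ (spine c _)       = +-monoˡ-≤ 1 (*-monoˡ-≤ t (n≤1+n c))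
  CombGen⇒≤ (tooth c j _ _ _) = m≤m+n _ 1

  ≤β⇒≤ : ∀ {x y} → x ≤β y → x ≤ y
  ≤β⇒≤ ε       = ≤-refl
  ≤β⇒≤ (g ◅ r) = ≤-trans (CombGen⇒≤ g) (≤β⇒≤ r)

  CombGen-inside-tooth : ∀ c {x y} → c * t + 2 ≤ x → x ≤ top c → CombGen s t x y → y ≤ top c
  CombGen-inside-tooth c lo hi (spine c' _) with <-cmp c' c
  ... | tri< c'<c _ _ = ⊥-elim (<⇒≱ (comb-< c'<c 1≤t (s≤s z≤n)) lo)
    where
    1≤t : 1 ≤ t
    1≤t = ≤-trans (s≤s z≤n) (+-cancelˡ-≤ (c * t) 2 t (≤-trans lo hi))
  ... | tri≈ _ refl _ = ⊥-elim (<⇒≱ (+-monoʳ-< (c * t) (s≤s (s≤s z≤n))) lo)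
  ... | tri> _ _ c<c' = ⊥-elim (<⇒≱ (comb-< c<c' ≤-refl (s≤s z≤n)) hi)
  CombGen-inside-tooth c lo hi (tooth c' j _ 1≤j j+1≤t) with <-cmp c' c
  ... | tri< c'<c _ _ = ⊥-elim (<⇒≱ (comb-< c'<c (≤-trans (n≤1+n j) (subst (_≤ t) (+-comm j 1) j+1≤t)) (s≤s z≤n)) lo)
  ... | tri≈ _ refl _ = subst (_≤ c * t + t) (sym (+-assoc (c * t) j 1)) (+-monoʳ-≤ (c * t) j+1≤t)
  ... | tri> _ _ c<c' = ⊥-elim (<⇒≱ (comb-< c<c' ≤-refl 1≤j) hi)

  ≤β-inside-tooth : ∀ c {x y} → c * t + 2 ≤ x → x ≤ top c → x ≤β y → y ≤ top c
  ≤β-inside-tooth c lo hi ε       = hi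
  ≤β-inside-tooth c lo hi (g ◅ r) =
    ≤β-inside-tooth c (≤-trans lo (CombGen⇒≤ g)) (CombGen-inside-tooth c lo hi g) r

  CombGen-along-tooth : ∀ {c x} → c < s → base c ≤ x → suc x ≤ top c → CombGen s t x (suc x)
  CombGen-along-tooth {c} {x} c<s lo hi
    with x ∸ c * t | m+[n∸m]≡n {c * t} {x} (≤-trans (m≤m+n _ 1) lo)
  ... | j | refl = subst (CombGen s t (c * t + j)) (+-comm (c * t + j) 1)
    (tooth c j c<s (+-cancelˡ-≤ (c * t) 1 j lo)
      (subst (_≤ t) (+-comm 1 j) (+-cancelˡ-≤ (c * t) (suc j) t (subst (_≤ c * t + t) (sym (+-suc (c * t) j)) hi))))

  ≤β-along-tooth : ∀ {c x} → c < s → base c ≤ x → ∀ y → x ≤ y → y ≤ top c → x ≤β y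
  ≤β-along-tooth c<s lo y x≤y hi with m≤n⇒m<n∨m≡n x≤y
  ... | inj₂ refl = ε
  ≤β-along-tooth c<s lo (suc y) x≤y hi | inj₁ (s≤s x≤y') =
    ≤β-along-tooth c<s lo y x≤y' (≤-trans (n≤1+n y) hi) ◅◅ (CombGen-along-tooth c<s (≤-trans lo x≤y') hi ◅ ε)

  comb-≤N : ∀ {c j} → c < s → j ≤ t → c * t + j ≤ N
  comb-≤N {c} {j} c<s j≤t =
    ≤-trans (+-monoʳ-≤ (c * t) j≤t) (subst (_≤ N) (+-comm t (c * t)) (*-monoˡ-≤ t c<s))

  comb-≤N⇒< : ∀ {c j} → 1 ≤ j → c * t + j ≤ N → c < s
  comb-≤N⇒< {c} {j} 1≤j ≤N with c <? s
  ... | yes c<s = c<s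
  ... | no c≮s = ⊥-elim (<⇒≱ (≤-<-trans (*-monoˡ-≤ t (≮⇒≥ c≮s)) (m<m+n (c * t) 1≤j)) ≤N)

  Spans : ℕ → List ℕ → Set
  Spans a v = ∀ x → (x ∈ v) ⇔ (a ≤ x × x ≤ N)

  record Admissible (v : List ℕ) : Set where
    constructor admissible
    field
      unique      : Unique v
      ordered     : AllPairs (λ x y → ¬ y ≤β x) v
      noBelowBoth : AllTriples (λ x y z → ¬ BelowBoth x y z) v

  Good : ℕ → List ℕ → Set
  Good a v = Admissible v × Spans a v

  LinearExtension∧Avoids⇔Good : ∀ v →
    (IsLinearExtension s t v × Avoids 2 3 1 v × Avoids 3 2 1 v) ⇔ Good 1 v
  LinearExtension∧Avoids⇔Good v = mk⇔
    (λ ((u , sp , ord) , avoids) →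
      admissible u (to (ListedInOrder⇔AllPairs v) ord) (to (Avoids231∧321⇔AllTriples v u) avoids) , sp)
    (λ (admissible u ord nbb , sp) →
      (u , sp , from (ListedInOrder⇔AllPairs v) ord) , from (Avoids231∧321⇔AllTriples v u) nbb)
    where open Equivalence

  Admissible-∷ : ∀ {x w} → All (x <_) w → Admissible w → Admissible (x ∷ w)
  Admissible-∷ x<w (admissible u ord nbb) = admissible
    (All.map <⇒≢ x<w ∷ u)
    (All.map (λ x<y y≤βx → <⇒≱ x<y (≤β⇒≤ y≤βx)) x<w ∷ ord)
    (above⇒¬BelowBoth x<w ∷ nbb)

  Admissible-run++ : ∀ p n {w} → All (p + n ≤_) w → Admissible w → Admissible (run p n ++ w)
  Admissible-run++ p zero    w≥ adm = adm
  Admissible-run++ p (suc n) {w} w≥ adm =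
    Admissible-∷ p<rest (Admissible-run++ (suc p) n (subst (λ m → All (m ≤_) w) (+-suc p n) w≥) adm)
    where
    p<rest : All (p <_) (run (suc p) n ++ w)
    p<rest = All.++⁺ (All-run (suc p) n (λ p<y _ → p<y)) (All.map (<-≤-trans (m<m+n p z<s)) w≥)

  Spans-∷ : ∀ {a w} → a ≤ N → Spans (suc a) w → Spans a (a ∷ w)
  Spans-∷ {a} {w} a≤N sp x = mk⇔ to from
    where
    to : x ∈ a ∷ w → a ≤ x × x ≤ N
    to (here refl)  = ≤-refl , a≤N
    to (there x∈w) = let a<x , x≤N = Equivalence.to (sp x) x∈w in <⇒≤ a<x , x≤N
    from : a ≤ x × x ≤ N → x ∈ a ∷ w
    from (a≤x , x≤N) with m≤n⇒m<n∨m≡n a≤x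
    ... | inj₁ a<x  = there (Equivalence.from (sp x) (a<x , x≤N))
    ... | inj₂ refl = here refl

  Spans-tail : ∀ {a w} → Unique (a ∷ w) → Spans a (a ∷ w) → Spans (suc a) w
  Spans-tail u sp x = ⇔-trans (∈-tail⇔ u sp x) interval-tail

  Spans-run++ : ∀ p n {w} → p + n ≤ suc N → Spans (p + n) w → Spans p (run p n ++ w)
  Spans-run++ p zero    {w} _     sp = subst (λ q → Spans q w) (+-identityʳ p) sp
  Spans-run++ p (suc n) {w} bound sp = Spans-∷ (s≤s⁻¹ (<-≤-trans (m<m+n p z<s) bound))
    (Spans-run++ (suc p) n (subst (_≤ suc N) (+-suc p n) bound) (subst (λ q → Spans q w) (+-suc p n) sp))

  Spans-resp-↭ : ∀ {a v v'} → v ↭ v' → Spans a v → Spans a v'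
  Spans-resp-↭ v↭v' sp x = ⇔-trans (mk⇔ (∈-resp-↭ (↭-sym v↭v')) (∈-resp-↭ v↭v')) (sp x)

  Spans⇒All≥ : ∀ {a w} → Spans a w → All (a ≤_) w
  Spans⇒All≥ sp = All.tabulate λ {y} y∈w → proj₁ (Equivalence.to (sp y) y∈w)

  Good-∷ : ∀ {a w} → a ≤ N → Good (suc a) w → Good a (a ∷ w)
  Good-∷ a≤N (adm , sp) = Admissible-∷ (Spans⇒All≥ sp) adm , Spans-∷ a≤N sp

  jump : ℕ → ℕ → List ℕ → List ℕ
  jump c j w = base (suc c) ∷ run (c * t + j) (suc t ∸ j) ++ w

  run-reaches-next-base : ∀ c j → j ≤ suc t → c * t + j + (suc t ∸ j) ≡ base (suc c)
  run-reaches-next-base c j j≤1+t = begin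
    c * t + j + (suc t ∸ j)    ≡⟨ +-assoc (c * t) j (suc t ∸ j) ⟩
    c * t + (j + (suc t ∸ j))  ≡⟨ cong (c * t +_) (m+[n∸m]≡n j≤1+t) ⟩
    c * t + suc t              ≡⟨ +-suc (c * t) t ⟩
    suc (top c)                ≡⟨ next-tooth-base t c ⟨
    base (suc c)               ∎
    where open ≡-Reasoning

  Good-jump : ∀ {c j w} → suc c < s → 2 ≤ j → j ≤ t →
    Good (suc (base (suc c))) w → Good (c * t + j) (jump c j w)
  Good-jump {c} {j} {w} c+1<s 2≤j j≤t (adm , sp) =
    admissible (on-tail (λ _ y<h → >⇒≢ y<h) <⇒≢ ∷ unique)
               (on-tail run⋠h (λ h<y y≤βh → <⇒≱ h<y (≤β⇒≤ y≤βh)) ∷ ordered)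
               (h-noBelowBoth ∷ noBelowBoth) ,
    Spans-resp-↭ (shift h (run a n) w)
      (Spans-run++ a n (subst (_≤ suc N) (sym a+n≡h) (m≤n⇒m≤1+n h≤N))
        (subst (λ q → Spans q (h ∷ w)) (sym a+n≡h) (Spans-∷ h≤N sp)))
    where
    a : ℕ
    a = c * t + j
    n : ℕ
    n = suc t ∸ j
    h : ℕ
    h = base (suc c)
    a+n≡h : a + n ≡ h
    a+n≡h = run-reaches-next-base c j (≤-trans j≤t (n≤1+n t))
    h≤N : h ≤ N
    h≤N = comb-≤N c+1<s (≤-trans (s≤s z≤n) (≤-trans 2≤j j≤t))
    h<w : All (h <_) w
    h<w = Spans⇒All≥ sp
    open Admissible (Admissible-run++ a n (All.map (λ {y} h<y → subst (_≤ y) (sym a+n≡h) (<⇒≤ h<y)) h<w) adm)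
    on-tail : ∀ {P : ℕ → Set} → (∀ {y} → a ≤ y → y < h → P y) → (∀ {y} → h < y → P y) →
      All P (run a n ++ w)
    on-tail run-case w-case = All.++⁺
      (All-run a n (λ {y} a≤y y<a+n → run-case a≤y (subst (y <_) a+n≡h y<a+n)))
      (All.map w-case h<w)
    run⋠h : ∀ {y} → a ≤ y → y < h → ¬ y ≤β h
    run⋠h {y} a≤y y<h y≤βh = <⇒≱ (s≤s ≤-refl)
      (subst (_≤ top c) (next-tooth-base t c)
        (≤β-inside-tooth c (≤-trans (+-monoʳ-≤ (c * t) 2≤j) a≤y)
          (s≤s⁻¹ (subst (y <_) (next-tooth-base t c) y<h)) y≤βh))
    h-noBelowBoth : AllPairs (λ y z → ¬ BelowBoth h y z) (run a n ++ w)
    h-noBelowBoth = AllPairs.++⁺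
      (AllPairs.map (λ y<z (_ , z<y) → <-asym y<z z<y) (run-increasing a n))
      (above⇒¬BelowBoth h<w)
      (All-run a n λ _ _ → All.map (λ h<z (z<h , _) → <-asym h<z z<h) h<w)

  Good-head : ∀ {c j x w} → 1 ≤ j → j ≤ t → Good (c * t + j) (x ∷ w) →
    x ≡ c * t + j ⊎ (2 ≤ j × suc c < s × x ≡ base (suc c))
  Good-head {c} {j} {x} {w} 1≤j j≤t (admissible _ (x⋠w ∷ _) _ , sp)
    with a≤x , x≤N ← Equivalence.to (sp x) (here refl)
    with m≤n⇒m<n∨m≡n a≤x
  ... | inj₂ a≡x = inj₁ (sym a≡x)
  ... | inj₁ a<x
    with c' , j' , 1≤j' , j'≤t , x≡ ← comb-coordinates (≤-trans 1≤j j≤t) x (≤-trans 1≤j (≤-trans (m≤n+m j (c * t)) a≤x))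
    = inj₂ (jump-head c' j' 1≤j' j'≤t x≡)
    where
    a : ℕ
    a = c * t + j
    below-start : ∀ {y} → y < x → y ≤β x → y < a
    below-start {y} y<x y≤βx with a ≤? y
    ... | no a≰y = ≰⇒> a≰y
    ... | yes a≤y with Equivalence.from (sp y) (a≤y , ≤-trans (<⇒≤ y<x) x≤N)
    ...   | here y≡x   = ⊥-elim (<⇒≢ y<x y≡x)
    ...   | there y∈w = ⊥-elim (All.lookup x⋠w y∈w y≤βx)
    c'<s : ∀ {c' j'} → 1 ≤ j' → x ≡ c' * t + j' → c' < s
    c'<s 1≤j' x≡ = comb-≤N⇒< 1≤j' (subst (_≤ N) x≡ x≤N)
    jump-head : ∀ c' j' → 1 ≤ j' → j' ≤ t → x ≡ c' * t + j' → 2 ≤ j × suc c < s × x ≡ base (suc c)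
    jump-head c' (suc (suc k)) 1≤j' j'≤t x≡ =
      ⊥-elim (<⇒≱ a<x (subst (_≤ a) (sym (trans x≡ (+-suc (c' * t) (suc k)))) (below-start y<x (g ◅ ε))))
      where
      y : ℕ
      y = c' * t + suc k
      y<x : y < x
      y<x = subst (y <_) (sym (trans x≡ (+-suc (c' * t) (suc k)))) ≤-refl
      g : CombGen s t y x
      g = subst (CombGen s t y) (trans (trans (+-assoc (c' * t) (suc k) 1) (cong (c' * t +_) (+-comm (suc k) 1))) (sym x≡))
            (tooth c' (suc k) (c'<s 1≤j' x≡) (s≤s z≤n) (subst (_≤ t) (+-comm 1 (suc k)) j'≤t))
    jump-head zero (suc zero) _ _ x≡1 =
      ⊥-elim (<⇒≱ a<x (subst (_≤ a) (sym x≡1) (≤-trans 1≤j (m≤n+m j (c * t)))))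
    jump-head (suc c'') (suc zero) 1≤j' _ x≡ = via-spine (below-start y<x y≤βx)
      where
      y : ℕ
      y = c'' * t + 1
      y<x : y < x
      y<x = subst (y <_) (sym x≡) (comb-< {c = c''} ≤-refl (≤-trans 1≤j j≤t) ≤-refl)
      y≤βx : y ≤β x
      y≤βx = subst (CombGen s t y) (sym x≡) (spine c'' (subst (_≤ s) (+-comm 2 c'') (c'<s 1≤j' x≡))) ◅ ε
      via-spine : y < a → 2 ≤ j × suc c < s × x ≡ base (suc c)
      via-spine y<a with <-cmp c'' c
      ... | tri< c''<c _ _ = ⊥-elim (<⇒≱ a<x (subst (_≤ a) (sym x≡) (+-mono-≤ (*-monoˡ-≤ t c''<c) 1≤j)))
      ... | tri≈ _ refl _ = +-cancelˡ-< (c * t) 1 j y<a , c'<s 1≤j' x≡ , x≡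
      ... | tri> _ _ c<c'' = ⊥-elim (<-asym y<a (comb-< c<c'' j≤t ≤-refl))

  -- p is the least unlisted element: an earlier entry y would satisfy p ≤β y (same tooth)
  -- or have p below both h and y.
  jump-tail-head : ∀ {c n p r} → 1 ≤ t → suc c < s → c * t + 2 ≤ p → p + suc n ≡ base (suc c) →
    Admissible r → AllPairs (λ y z → ¬ BelowBoth (base (suc c)) y z) r →
    (∀ x → x ∈ r ⇔ (p ≤ x × x ≤ N × x ≢ base (suc c))) →
    ∃[ r' ] (r ≡ p ∷ r')
  jump-tail-head {c} {p = p} 1≤t c+1<s lo p+n≡h (admissible _ ord _) h-nbb r⇔ =
    from-head (Equivalence.from (r⇔ p) (≤-refl , ≤-trans (<⇒≤ p<h) (comb-≤N c+1<s 1≤t) , <⇒≢ p<h)) ord h-nbb r⇔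
    where
    h : ℕ
    h = base (suc c)
    p<h : p < h
    p<h = subst (p <_) p+n≡h (m<m+n p z<s)
    from-head : ∀ {r} → p ∈ r → AllPairs (λ x y → ¬ y ≤β x) r → AllPairs (λ y z → ¬ BelowBoth h y z) r →
      (∀ x → x ∈ r ⇔ (p ≤ x × x ≤ N × x ≢ h)) → ∃[ r' ] (r ≡ p ∷ r')
    from-head {r = y ∷ r'} (here refl) _ _ _ = r' , refl
    from-head {r = y ∷ r'} (there p∈r') (y⋠r' ∷ _) (h-nbb-y ∷ _) r⇔
      with p≤y , _ , y≢h ← Equivalence.to (r⇔ y) (here refl) with y ≤? top c
    ... | yes y≤top = ⊥-elim (All.lookup y⋠r' p∈r'
          (≤β-along-tooth (<-trans (n<1+n c) c+1<s) (≤-trans (+-monoʳ-≤ (c * t) (s≤s z≤n)) lo) y p≤y y≤top))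
    ... | no y≰top = ⊥-elim (All.lookup h-nbb-y p∈r' (p<h , <-trans p<h h<y))
      where
      h<y : h < y
      h<y = ≤∧≢⇒< (subst (_≤ y) (sym (next-tooth-base t c)) (≰⇒> y≰top)) (y≢h ∘ sym)

  jump-tail : ∀ {c} → 1 ≤ t → suc c < s → ∀ n p {r} → c * t + 2 ≤ p → p + n ≡ base (suc c) →
    Admissible r → AllPairs (λ y z → ¬ BelowBoth (base (suc c)) y z) r →
    (∀ x → x ∈ r ⇔ (p ≤ x × x ≤ N × x ≢ base (suc c))) →
    ∃[ w ] (r ≡ run p n ++ w × Good (suc (base (suc c))) w)
  jump-tail _ _ zero p {r} _ p+0≡h adm _ r⇔ with refl ← trans (sym (+-identityʳ p)) p+0≡h =
    r , refl , adm , λ x → ⇔-trans (r⇔ x) (mk⇔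
      (λ (h≤x , x≤N , x≢h) → ≤∧≢⇒< h≤x (x≢h ∘ sym) , x≤N)
      (λ (h<x , x≤N) → <⇒≤ h<x , x≤N , >⇒≢ h<x))
  jump-tail 1≤t c+1<s (suc n) p lo p+n≡h adm h-nbb r⇔
    with r' , refl ← jump-tail-head 1≤t c+1<s lo p+n≡h adm h-nbb r⇔
    with admissible u@(_ ∷ u') (_ ∷ ord) (_ ∷ nbb) ← adm | _ ∷ h-nbb' ← h-nbb
    with w , r'≡ , good ← jump-tail 1≤t c+1<s n (suc p) (≤-trans lo (n≤1+n p))
           (trans (sym (+-suc p n)) p+n≡h) (admissible u' ord nbb) h-nbb'
           (λ x → ⇔-trans (∈-tail⇔ u r⇔ x) interval-tail)
    = w , cong (p ∷_) r'≡ , good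

  Good-inversion : ∀ {c j v} → c < s → 1 ≤ j → j ≤ t → Good (c * t + j) v →
    Image (c * t + j ∷_) (Good (suc (c * t + j))) v ⊎
    (2 ≤ j × suc c < s × Image (jump c j) (Good (suc (base (suc c)))) v)
  Good-inversion {c} {j} {[]} c<s _ j≤t (_ , sp)
    with () ← Equivalence.from (sp (c * t + j)) (≤-refl , comb-≤N c<s j≤t)
  Good-inversion {c} {j} {x ∷ w} _ 1≤j j≤t good@(admissible u@(_ ∷ u') (_ ∷ ord) (h-nbb ∷ nbb) , sp)
    with Good-head {c} 1≤j j≤t good
  ... | inj₁ refl = inj₁ (w , refl , admissible u' ord nbb , Spans-tail u sp)
  ... | inj₂ (2≤j , c+1<s , refl)
    with w' , refl , good' ← jump-tail (≤-trans 1≤j j≤t) c+1<s (suc t ∸ j) (c * t + j)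
           (+-monoʳ-≤ (c * t) 2≤j) (run-reaches-next-base c j (m≤n⇒m≤1+n j≤t))
           (admissible u' ord nbb) h-nbb
           (λ y → ⇔-trans (∈-tail⇔ u sp y) (mk⇔ (λ ((a≤y , y≤N) , y≢h) → a≤y , y≤N , y≢h)
                                                (λ (a≤y , y≤N , y≢h) → (a≤y , y≤N) , y≢h)))
    = inj₂ (2≤j , c+1<s , w' , refl , good')

  Count : ℕ → ℕ → Set
  Count a = Enumeration (Good a)

  count-end : Count (suc N) 1
  count-end = [] ∷ [] , [] ∷ [] , (λ v → mk⇔ only-empty (empty v)) , refl
    where
    only-empty : ∀ {v} → v ∈ [] ∷ [] → Good (suc N) v
    only-empty (here refl) = admissible [] [] [] , λ x → mk⇔ (λ ()) (λ (N<x , x≤N) → ⊥-elim (<⇒≱ N<x x≤N))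
    empty : ∀ v → Good (suc N) v → v ∈ [] ∷ []
    empty []      _        = here refl
    empty (x ∷ _) (_ , sp) = let N<x , x≤N = Equivalence.to (sp x) (here refl) in ⊥-elim (<⇒≱ N<x x≤N)

  count-stay : ∀ {c j n} → c < s → 1 ≤ j → j ≤ t → ¬ (2 ≤ j × suc c < s) →
    Count (suc (c * t + j)) n → Count (c * t + j) n
  count-stay c<s 1≤j j≤t no-jump E = Enumeration-resp-⇔
    (λ v → mk⇔ (λ { (w , refl , good) → Good-∷ (comb-≤N c<s j≤t) good })
               (λ good → [ id , (λ (2≤j , c+1<s , _) → ⊥-elim (no-jump (2≤j , c+1<s))) ]′
                             (Good-inversion c<s 1≤j j≤t good)))
    (Enumeration-map ∷-injectiveʳ E)

  count-branch : ∀ {c j n m} → suc c < s → 2 ≤ j → j ≤ t →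
    Count (suc (c * t + j)) n → Count (suc (base (suc c))) m → Count (c * t + j) (n + m)
  count-branch {c} {j} c+1<s 2≤j j≤t E F = Enumeration-resp-⇔
    (λ v → mk⇔ [ (λ { (w , refl , good) → Good-∷ (comb-≤N c<s j≤t) good })
               , (λ { (w , refl , good) → Good-jump c+1<s 2≤j j≤t good }) ]′
               (λ good → [ inj₁ , inj₂ ∘ proj₂ ∘ proj₂ ]′ (Good-inversion c<s (≤-trans (s≤s z≤n) 2≤j) j≤t good)))
    (Enumeration-⊎ (λ { _ (_ , refl , _) (_ , a∷w≡jump , _) → <⇒≢ a<h (∷-injectiveˡ a∷w≡jump) })
      (Enumeration-map ∷-injectiveʳ E)
      (Enumeration-map (λ jump≡jump → ++-cancelˡ (base (suc c) ∷ run (c * t + j) (suc t ∸ j)) _ _ jump≡jump) F))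
    where
    c<s : c < s
    c<s = <-trans (n<1+n c) c+1<s
    a<h : c * t + j < base (suc c)
    a<h = subst (c * t + j <_) (sym (next-tooth-base t c)) (s≤s (+-monoʳ-≤ (c * t) j≤t))

  -- Here j runs up to t + 1, where c * t + j is the base of the next tooth (N + 1 on the last one).
  count-last-tooth : ∀ {c} → suc c ≡ s → ∀ d j → 1 ≤ j → j + d ≡ suc t → Count (c * t + j) 1
  count-last-tooth {c} c+1≡s zero j _ j+0≡1+t = subst (λ a → Count a 1) end≡ count-end
    where
    end≡ : suc N ≡ c * t + j
    end≡ = begin
      suc (s * t)        ≡⟨ cong (λ m → suc (m * t)) c+1≡s ⟨
      suc (t + c * t)    ≡⟨ cong suc (+-comm t (c * t)) ⟩
      suc (c * t + t)    ≡⟨ +-suc (c * t) t ⟨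
      c * t + suc t      ≡⟨ cong (c * t +_) (trans (sym (+-identityʳ j)) j+0≡1+t) ⟨
      c * t + j          ∎
      where open ≡-Reasoning
  count-last-tooth {c} c+1≡s (suc d) j 1≤j j+d≡1+t =
    count-stay (subst (c <_) c+1≡s ≤-refl) 1≤j (s≤s⁻¹ (subst (j <_) j+d≡1+t (m<m+n j z<s)))
      (λ (_ , c+1<s) → <-irrefl c+1≡s c+1<s)
      (subst (λ a → Count a 1) (+-suc (c * t) j)
        (count-last-tooth c+1≡s d (suc j) (s≤s z≤n) (trans (sym (+-suc j d)) j+d≡1+t)))

  count-inner-tooth : ∀ {c T} → suc c < s → Count (suc c * t + 1) T → Count (suc c * t + 2) T →
    ∀ d j → 2 ≤ j → j + d ≡ suc t → Count (c * t + j) (suc d * T)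
  count-inner-tooth {c} {T} _ E _ zero j _ j+0≡1+t =
    subst₂ Count base≡ (sym (+-identityʳ T)) E
    where
    base≡ : base (suc c) ≡ c * t + j
    base≡ = trans (next-tooth-base t c)
      (trans (sym (+-suc (c * t) t)) (cong (c * t +_) (sym (trans (sym (+-identityʳ j)) j+0≡1+t))))
  count-inner-tooth {c} {T} c+1<s E F (suc d) j 2≤j j+d≡1+t =
    subst (Count (c * t + j)) (+-comm (suc d * T) T)
      (count-branch c+1<s 2≤j (s≤s⁻¹ (subst (j <_) j+d≡1+t (m<m+n j z<s)))
        (subst (λ a → Count a (suc d * T)) (+-suc (c * t) j)
          (count-inner-tooth c+1<s E F d (suc j) (m≤n⇒m≤1+n 2≤j) (trans (sym (+-suc j d)) j+d≡1+t)))
        (subst (λ a → Count a T) (+-suc (suc c * t) 1) F))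

  count-tooth : 1 ≤ t → ∀ d c → d + suc c ≡ s → Count (c * t + 1) (t ^ d) × Count (c * t + 2) (t ^ d)
  count-tooth 1≤t zero c c+1≡s =
    count-last-tooth c+1≡s t 1 ≤-refl refl ,
    count-last-tooth c+1≡s (t ∸ 1) 2 (s≤s z≤n) (cong suc (m+[n∸m]≡n 1≤t))
  count-tooth 1≤t (suc d) c d+c+2≡s =
    count-stay (<-trans (n<1+n c) c+1<s) ≤-refl 1≤t (λ { (s≤s () , _) })
      (subst (λ a → Count a (t ^ suc d)) (+-suc (c * t) 1) second) ,
    second
    where
    c+1<s : suc c < s
    c+1<s = subst (suc c <_) d+c+2≡s (s≤s (m≤n+m (suc c) d))
    next : Count (suc c * t + 1) (t ^ d) × Count (suc c * t + 2) (t ^ d)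
    next = count-tooth 1≤t d (suc c) (trans (+-suc d (suc c)) d+c+2≡s)
    second : Count (c * t + 2) (t ^ suc d)
    second = subst (λ n → Count (c * t + 2) (n * t ^ d)) (m+[n∸m]≡n 1≤t)
      (count-inner-tooth c+1<s (proj₁ next) (proj₂ next) (t ∸ 1) 2 ≤-refl (cong suc (m+[n∸m]≡n 1≤t)))

theorem21 : (s t : ℕ) → 1 ≤ s → 1 ≤ t →
    ∃[ L ] (Unique L ×
      (∀ (v : List ℕ) → (v ∈ L) ⇔ (IsLinearExtension s t v × Avoids 2 3 1 v × Avoids 3 2 1 v)) ×
      length L ≡ t ^ (s ∸ 1))
theorem21 s t 1≤s 1≤t =
  Enumeration-resp-⇔ (λ v → ⇔-sym (LinearExtension∧Avoids⇔Good v))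
    (proj₁ (count-tooth 1≤t (s ∸ 1) 0 (m∸n+n≡m 1≤s)))
  where open Comb s t
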